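{- Let $|q|<1$ and $w\in\mathbb{C}$. For nonnegative integers $n,m$, let $P(n,m)$ be the number of partitions of $n$ in which exactly $m$ positive integers less than the largest part are missing (with $P(0,0)=1$, the empty partition having no missing integers). Then \[ \sum_{n=0}^{\infty}\sum_{m=0}^{\infty} P(n,m)w^mq^n=\frac{((w-1)q;q)_{\infty}}{(wq;q)_{\infty}}. \]
   Context: For a partition $\pi$ with largest part $L$, a missing integer of $\pi$ is a positive integer less than $L$ that does not occur as a part of $\pi$. Notation: $(a;q)_\infty=\prod_{i\ge1}(1-aq^{i-1})$. -}

module Defs where

open import Data.Nat using (ℕ; zero; suc; _≤_; _<_; _≟_; _∸_)
import Data.Nat as ℕ
open import Data.Integer using (ℤ; +_; -_; _+_; _*_)
open import Data.List using (List; []; _∷_; length; filter; upTo; map)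
open import Data.Nat.ListAction using (sum)
open import Data.List.Relation.Unary.All using (All)
open import Data.List.Relation.Unary.Linked using (Linked)
open import Data.List.Membership.DecPropositional _≟_ using (_∈?_)
open import Data.Product using (Σ; _×_)
open import Relation.Nullary using (¬?)
open import Relation.Nullary.Decidable using (does)
open import Relation.Binary.PropositionalEquality using (_≡_)
open import Function.Bundles using (_↔_)
open import Data.Fin using (Fin)
open import Data.Bool using (if_then_else_)

IsPartition : ℕ → List ℕ → Set
IsPartition n π = All (0 <_) π × Linked ℕ._≥_ π × sum π ≡ n

largest : List ℕ → ℕ
largest []      = 0
largest (x ∷ _) = x

missing : List ℕ → ℕ
missing π = length (filter (λ k → ¬? (k ∈? π)) (map suc (upTo (largest π ∸ 1))))

PartsWithMissing : ℕ → ℕ → Set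
PartsWithMissing n m = Σ (List ℕ) (λ π → IsPartition n π × missing π ≡ m)

HasCard : Set → ℕ → Set
HasCard A k = A ↔ Fin k

-- Formal power series in q and w with integer coefficients.
-- f n m is the coefficient of q^n w^m.

PS : Set
PS = ℕ → ℕ → ℤ

sumTo : ℕ → (ℕ → ℤ) → ℤ
sumTo zero    f = f 0
sumTo (suc n) f = sumTo n f + f (suc n)

one : PS
one zero zero = + 1
one _    _    = + 0

_⊛_ : PS → PS → PS
(f ⊛ g) n m = sumTo n (λ a → sumTo m (λ b → f a b * g (n ∸ a) (m ∸ b)))

-- 1 - (w-1) q^i  =  1 + q^i - w q^i   (used for i ≥ 1)
numFactor : ℕ → PS
numFactor i n m =
  (if does (n ≟ 0) ∧' does (m ≟ 0) then + 1 else + 0)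
  + (if does (n ≟ i) ∧' does (m ≟ 0) then + 1 else + 0)
  + (if does (n ≟ i) ∧' does (m ≟ 1) then - (+ 1) else + 0)
  where
  open import Data.Bool using () renaming (_∧_ to _∧'_)

-- 1 / (1 - w q^i) = Σ_{k ≥ 0} w^k q^{i k}
denFactor : ℕ → PS
denFactor i n m = if does (n ≟ i ℕ.* m) then + 1 else + 0

partialProduct : ℕ → PS
partialProduct zero    = one
partialProduct (suc N) =
  partialProduct N ⊛ (numFactor (suc N) ⊛ denFactor (suc N))

-- Write a partition with its parts in increasing order and pad it with zeros to length N, which is
-- possible once N ≥ n: partitions of n become weakly increasing N-tuples v₁ ≤ … ≤ v_N of naturals.
-- Their differences dᵢ = vᵢ − vᵢ₋₁ (with v₀ = 0) are unconstrained, the tuple has size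
-- Σᵢ (N − i + 1) dᵢ, and its missing integers number Σᵢ (dᵢ ∸ 1). So the tuples are counted by
-- ∏_{i=1}^{N} (1 + Σ_{d≥1} w^{d−1} q^{i d}) = ∏_{i=1}^{N} (1 − (w−1) qⁱ) / (1 − w qⁱ).
-- Removing the smallest entry d = v₁ and subtracting it from the others maps N-tuples bijectively
-- to pairs of an (N − 1)-tuple and d, which accounts for the factor i = N.

module Submission where

open import Defs
open import Algebra.Properties.AbelianGroup using (xyx⁻¹≈y)
import Algebra.Properties.CommutativeSemigroup as CommutativeSemigroupProperties
open import Data.Bool using (true; false; if_then_else_; _∧_)
open import Data.Empty using (⊥-elim)
open import Data.Fin using (zero)
open import Data.Fin.Permutation using (↔⇒≡)
open import Data.Fin.Properties using (+↔⊎; *↔×)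
open import Data.Integer.Base as ℤ using (ℤ; +_; -_)
import Data.Integer.Properties as ℤ
open import Data.List using (List; []; _∷_; head; length; filter; upTo; map; reverse; reverseAcc; replicate; _++_; [_])
import Data.List.Properties as List
open import Data.List.Relation.Unary.All as All using (All; []; _∷_)
open import Data.List.Relation.Unary.AllPairs using (_∷_)
open import Data.List.Relation.Unary.Any using (here; there)
open import Data.List.Relation.Unary.Linked as Linked using (Linked; []; [-]; _∷_; _∷′_)
open import Data.List.Relation.Unary.Linked.Properties using (Linked⇒All; Linked⇒AllPairs; map⁺)
open import Data.List.Relation.Binary.Permutation.Propositional using (↭-sym)
open import Data.List.Relation.Binary.Permutation.Propositional.Properties using (↭-reverse; All-resp-↭)
open import Data.Maybe using (just)
open import Data.Maybe.Relation.Binary.Connected using (Connected; just; just-nothing)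
open import Data.Nat using (ℕ; zero; suc; _+_; _*_; _∸_; _≟_; _≤?_; _≤_; _<_; _≥_; z≤n; s≤s)
import Data.Nat.Properties as ℕ
open import Data.List.Membership.DecPropositional _≟_ using (_∈?_; _∉?_; _∈_; _∉_)
open import Data.Nat.ListAction using (sum)
open import Data.Nat.ListAction.Properties using (sum-↭)
open import Data.Product using (Σ; _×_; _,_; proj₁; proj₂)
open import Data.Product.Function.Dependent.Propositional using (Σ-↔)
open import Data.Product.Function.NonDependent.Propositional using (_×-cong_)
open import Data.Sum using (_⊎_; inj₁; inj₂)
open import Data.Sum.Function.Propositional using (_⊎-cong_)
open import Function using (_∘_; flip)
open import Function.Bundles using (_↔_; mk↔ₛ′; mk⇔; Inverse)
open import Function.Properties.Inverse using (↔-refl; ↔-sym; ↔-trans)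
open import Relation.Nullary using (¬_; Dec; does; yes; no)
open import Relation.Nullary.Decidable using (map′; dec-true; dec-false; does-⇔)
open import Relation.Nullary.Irrelevant using (Irrelevant)
open import Relation.Binary.PropositionalEquality using (_≡_; refl; sym; trans; cong; cong₂; module ≡-Reasoning)
open ≡-Reasoning

module ℕ+ = CommutativeSemigroupProperties ℕ.+-commutativeSemigroup
module ℤ+ = CommutativeSemigroupProperties ℤ.+-commutativeSemigroup

card-unique : {A : Set} {k l : ℕ} → HasCard A k → HasCard A l → k ≡ l
card-unique f g = ↔⇒≡ (↔-trans (↔-sym f) g)

card-resp-≡ : {A : Set} {k l : ℕ} → k ≡ l → HasCard A k → HasCard A l
card-resp-≡ refl card = card

card-empty : {A : Set} → ¬ A → HasCard A 0
card-empty ¬a = mk↔ₛ′ (⊥-elim ∘ ¬a) (λ ()) (λ ()) (⊥-elim ∘ ¬a)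

card-singleton : {A : Set} (a : A) → (∀ x → x ≡ a) → HasCard A 1
card-singleton a unique = mk↔ₛ′ (λ _ → zero) (λ _ → a) (λ { zero → refl }) (sym ∘ unique)

card-⊎ : {A B : Set} {k l : ℕ} → HasCard A k → HasCard B l → HasCard (A ⊎ B) (k + l)
card-⊎ f g = ↔-trans (f ⊎-cong g) (↔-sym +↔⊎)

card-× : {A B : Set} {k l : ℕ} → HasCard A k → HasCard B l → HasCard (A × B) (k * l)
card-× f g = ↔-trans (f ×-cong g) (↔-sym *↔×)

card-Dec : {A : Set} → Irrelevant A → (A? : Dec A) → HasCard A (if does A? then 1 else 0)
card-Dec irr (yes a) = card-singleton a (λ x → irr x a)
card-Dec irr (no ¬a) = card-empty ¬a

card-≡ : ∀ a b → HasCard (a ≡ b) (if does (b ≟ a) then 1 else 0)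
card-≡ a b = card-Dec ℕ.≡-irrelevant (map′ sym sym (b ≟ a))

sumℕ : ℕ → (ℕ → ℕ) → ℕ
sumℕ zero    f = f 0
sumℕ (suc n) f = sumℕ n f + f (suc n)

sumℕ-suc : ∀ n f → sumℕ (suc n) f ≡ f 0 + sumℕ n (f ∘ suc)
sumℕ-suc zero    f = refl
sumℕ-suc (suc n) f = trans (cong (_+ f (suc (suc n))) (sumℕ-suc n f)) (ℕ.+-assoc (f 0) _ _)

_⊛ℕ_ : (ℕ → ℕ → ℕ) → (ℕ → ℕ → ℕ) → ℕ → ℕ → ℕ
(f ⊛ℕ g) n m = sumℕ n (λ a → sumℕ m (λ b → f a b * g (n ∸ a) (m ∸ b)))

Split : ℕ → (ℕ → ℕ → Set) → Set
Split n P = Σ ℕ λ a → Σ ℕ λ x → a + x ≡ n × P a x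

Split-zero↔ : {P : ℕ → ℕ → Set} → Split 0 P ↔ P 0 0
Split-zero↔ {P} = mk↔ₛ′ to (λ p → 0 , 0 , refl , p) (λ _ → refl) from-to
  where
  to : Split 0 P → P 0 0
  to (zero , zero , refl , p) = p
  from-to : ∀ s → (0 , 0 , refl , to s) ≡ s
  from-to (zero , zero , refl , p) = refl

Split-suc↔ : ∀ {n} {P : ℕ → ℕ → Set} → Split (suc n) P ↔ (P 0 (suc n) ⊎ Split n (P ∘ suc))
Split-suc↔ {n} {P} = mk↔ₛ′ to from to-from from-to
  where
  to : Split (suc n) P → P 0 (suc n) ⊎ Split n (P ∘ suc)
  to (zero  , x , refl , p) = inj₁ p
  to (suc a , x , e    , p) = inj₂ (a , x , ℕ.suc-injective e , p)
  from : P 0 (suc n) ⊎ Split n (P ∘ suc) → Split (suc n) P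
  from (inj₁ p)               = 0 , suc n , refl , p
  from (inj₂ (a , x , e , p)) = suc a , x , cong suc e , p
  to-from : ∀ s → to (from s) ≡ s
  to-from (inj₁ p)               = refl
  to-from (inj₂ (a , x , e , p)) = cong (λ e → inj₂ (a , x , e , p)) (ℕ.≡-irrelevant _ _)
  from-to : ∀ s → from (to s) ≡ s
  from-to (zero  , x , refl , p) = refl
  from-to (suc a , x , e    , p) = cong (λ e → suc a , x , e , p) (ℕ.≡-irrelevant _ _)

card-Split : ∀ n {P : ℕ → ℕ → Set} {f : ℕ → ℕ → ℕ} → (∀ a x → HasCard (P a x) (f a x)) →
             HasCard (Split n P) (sumℕ n (λ a → f a (n ∸ a)))
card-Split zero    card = ↔-trans Split-zero↔ (card 0 0)
card-Split (suc n) {f = f} card =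
  card-resp-≡ (sym (sumℕ-suc n (λ a → f a (suc n ∸ a))))
    (↔-trans Split-suc↔ (card-⊎ (card 0 (suc n)) (card-Split n (card ∘ suc))))

Convolution : (ℕ → ℕ → Set) → (ℕ → ℕ → Set) → ℕ → ℕ → Set
Convolution A B n m = Split n λ a x → Split m λ b y → A a b × B x y

card-Convolution : {A B : ℕ → ℕ → Set} {f g : ℕ → ℕ → ℕ} →
  (∀ a b → HasCard (A a b) (f a b)) → (∀ x y → HasCard (B x y) (g x y)) →
  ∀ n m → HasCard (Convolution A B n m) ((f ⊛ℕ g) n m)
card-Convolution cardA cardB n m =
  card-Split n (λ a x → card-Split m (λ b y → card-× (cardA a b) (cardB x y)))

-- s and t play the roles of the exponents of q and w.
Fiber : {X : Set} → (X → ℕ) → (X → ℕ) → ℕ → ℕ → Set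
Fiber {X} s t n m = Σ X λ x → s x ≡ n × t x ≡ m

Fiber-↔ : {X Y : Set} {s t : X → ℕ} {s′ t′ : Y → ℕ} (φ : Y ↔ X) →
  (∀ y → s (Inverse.to φ y) ≡ s′ y) → (∀ y → t (Inverse.to φ y) ≡ t′ y) →
  ∀ {n m} → Fiber s′ t′ n m ↔ Fiber s t n m
Fiber-↔ φ s≡ t≡ = Σ-↔ φ (λ {y} → ≡-↔ (s≡ y) ×-cong ≡-↔ (t≡ y))
  where
  ≡-↔ : ∀ {a b n : ℕ} → a ≡ b → (b ≡ n) ↔ (a ≡ n)
  ≡-↔ refl = ↔-refl

Fiber-×↔Convolution : {Y Z : Set} {s t : Y → ℕ} {s′ t′ : Z → ℕ} {n m : ℕ} →
  Fiber {Y × Z} (λ (y , z) → s y + s′ z) (λ (y , z) → t y + t′ z) n m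
    ↔ Convolution (Fiber s t) (Fiber s′ t′) n m
Fiber-×↔Convolution {s = s} {t} {s′} {t′} = mk↔ₛ′ to from to-from (λ _ → refl)
  where
  to : ∀ {n m} → Fiber _ _ n m → Convolution (Fiber s t) (Fiber s′ t′) n m
  to ((y , z) , e₁ , e₂) = s y , s′ z , e₁ , t y , t′ z , e₂ , (y , refl , refl) , (z , refl , refl)
  from : ∀ {n m} → Convolution (Fiber s t) (Fiber s′ t′) n m → Fiber _ _ n m
  from (_ , _ , e₁ , _ , _ , e₂ , (y , refl , refl) , (z , refl , refl)) = (y , z) , e₁ , e₂
  to-from : ∀ {n m} (c : Convolution (Fiber s t) (Fiber s′ t′) n m) → to (from c) ≡ c
  to-from (_ , _ , _ , _ , _ , _ , (_ , refl , refl) , (_ , refl , refl)) = refl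

×-irrelevant : {A B : Set} → Irrelevant A → Irrelevant B → Irrelevant (A × B)
×-irrelevant irrA irrB (a , b) (a′ , b′) = cong₂ _,_ (irrA a a′) (irrB b b′)

Σ-≡-irrelevant : {A : Set} {P : A → Set} → (∀ {a} → Irrelevant (P a)) →
                 {x y : Σ A P} → proj₁ x ≡ proj₁ y → x ≡ y
Σ-≡-irrelevant irr {a , p} {.a , q} refl = cong (a ,_) (irr p q)

Fiber-≡ : {P : List ℕ → Set} → (∀ {v} → Irrelevant (P v)) → {s t : Σ (List ℕ) P → ℕ} {n m : ℕ}
          {x y : Fiber s t n m} → proj₁ (proj₁ x) ≡ proj₁ (proj₁ y) → x ≡ y
Fiber-≡ irr e = Σ-≡-irrelevant (×-irrelevant ℕ.≡-irrelevant ℕ.≡-irrelevant) (Σ-≡-irrelevant irr e)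

sumTo-cong : ∀ n {f g : ℕ → ℤ} → (∀ a → f a ≡ g a) → sumTo n f ≡ sumTo n g
sumTo-cong zero    f≡g = f≡g 0
sumTo-cong (suc n) f≡g = cong₂ ℤ._+_ (sumTo-cong n f≡g) (f≡g (suc n))

sumTo-+ : ∀ n (f g : ℕ → ℤ) → sumTo n (λ a → f a ℤ.+ g a) ≡ sumTo n f ℤ.+ sumTo n g
sumTo-+ zero    f g = refl
sumTo-+ (suc n) f g = trans (cong (ℤ._+ (f (suc n) ℤ.+ g (suc n))) (sumTo-+ n f g))
                            (ℤ+.interchange (sumTo n f) (sumTo n g) (f (suc n)) (g (suc n)))

sumTo-pos : ∀ n (f : ℕ → ℕ) → sumTo n (λ a → + f a) ≡ + sumℕ n f
sumTo-pos zero    f = refl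
sumTo-pos (suc n) f = trans (cong (ℤ._+ + f (suc n)) (sumTo-pos n f)) (sym (ℤ.pos-+ (sumℕ n f) (f (suc n))))

sumTo-zero : ∀ n → sumTo n (λ _ → + 0) ≡ + 0
sumTo-zero zero    = refl
sumTo-zero (suc n) = cong (ℤ._+ + 0) (sumTo-zero n)

sumTo-if : ∀ n b (h : ℕ → ℤ) → sumTo n (λ a → if b then h a else + 0) ≡ (if b then sumTo n h else + 0)
sumTo-if n true  h = refl
sumTo-if n false h = sumTo-zero n

if-≟-≢ : {A : Set} (a i : ℕ) (z w : A) → ¬ a ≡ i → (if does (a ≟ i) then z else w) ≡ w
if-≟-≢ a i z w a≢i = cong (λ b → if b then z else w) (dec-false (a ≟ i) a≢i)

if-≟-refl : {A : Set} (a : ℕ) (z w : A) → (if does (a ≟ a) then z else w) ≡ z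
if-≟-refl a z w = cong (λ b → if b then z else w) (dec-true (a ≟ a) refl)

sumTo-δ-< : ∀ {n i} (h : ℕ → ℤ) → n < i → sumTo n (λ a → if does (a ≟ i) then h a else + 0) ≡ + 0
sumTo-δ-< {zero}  {suc i} h n<i = refl
sumTo-δ-< {suc n} {i}     h n<i =
  cong₂ ℤ._+_ (sumTo-δ-< h (ℕ.<-trans (ℕ.n<1+n n) n<i))
              (if-≟-≢ (suc n) i (h (suc n)) (+ 0) λ { refl → ℕ.<-irrefl refl n<i })

sumTo-δ : ∀ {n i} (h : ℕ → ℤ) → i ≤ n → sumTo n (λ a → if does (a ≟ i) then h a else + 0) ≡ h i
sumTo-δ {zero}      h z≤n = refl
sumTo-δ {suc n} {i} h i≤n with ℕ.m≤n⇒m<n∨m≡n i≤n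
... | inj₁ (s≤s i≤n′) =
  trans (cong₂ ℤ._+_ (sumTo-δ h i≤n′) (if-≟-≢ (suc n) i (h (suc n)) (+ 0) λ { refl → ℕ.1+n≰n i≤n′ }))
        (ℤ.+-identityʳ (h i))
... | inj₂ refl =
  trans (cong₂ ℤ._+_ (sumTo-δ-< h (ℕ.n<1+n n)) (if-≟-refl (suc n) (h (suc n)) (+ 0)))
        (ℤ.+-identityˡ (h (suc n)))

_⊕_ : PS → PS → PS
(f ⊕ g) n m = f n m ℤ.+ g n m

toPS : (ℕ → ℕ → ℕ) → PS
toPS f n m = + f n m

⊛-cong : ∀ {f f′ g g′ : PS} → (∀ a b → f a b ≡ f′ a b) → (∀ a b → g a b ≡ g′ a b) →
         ∀ n m → (f ⊛ g) n m ≡ (f′ ⊛ g′) n m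
⊛-cong f≡ g≡ n m = sumTo-cong n λ a → sumTo-cong m λ b → cong₂ ℤ._*_ (f≡ a b) (g≡ (n ∸ a) (m ∸ b))

⊛-distribʳ-⊕ : ∀ (f g h : PS) n m → ((f ⊕ g) ⊛ h) n m ≡ (f ⊛ h) n m ℤ.+ (g ⊛ h) n m
⊛-distribʳ-⊕ f g h n m = begin
  sumTo n (λ a → sumTo m (λ b → (f a b ℤ.+ g a b) ℤ.* h′ a b))
    ≡⟨ sumTo-cong n (λ a → sumTo-cong m λ b → ℤ.*-distribʳ-+ (h′ a b) (f a b) (g a b)) ⟩
  sumTo n (λ a → sumTo m (λ b → f a b ℤ.* h′ a b ℤ.+ g a b ℤ.* h′ a b))
    ≡⟨ sumTo-cong n (λ a → sumTo-+ m _ _) ⟩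
  sumTo n (λ a → sumTo m (λ b → f a b ℤ.* h′ a b) ℤ.+ sumTo m (λ b → g a b ℤ.* h′ a b))
    ≡⟨ sumTo-+ n _ _ ⟩
  (f ⊛ h) n m ℤ.+ (g ⊛ h) n m ∎
  where
  h′ : ℕ → ℕ → ℤ
  h′ a b = h (n ∸ a) (m ∸ b)

⊛-toPS : ∀ f g n m → (toPS f ⊛ toPS g) n m ≡ toPS (f ⊛ℕ g) n m
⊛-toPS f g n m = begin
  sumTo n (λ a → sumTo m (λ b → + f a b ℤ.* + g (n ∸ a) (m ∸ b)))
    ≡⟨ sumTo-cong n (λ a → sumTo-cong m λ b → sym (ℤ.pos-* (f a b) (g (n ∸ a) (m ∸ b)))) ⟩
  sumTo n (λ a → sumTo m (λ b → + (f a b * g (n ∸ a) (m ∸ b))))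
    ≡⟨ sumTo-cong n (λ a → sumTo-pos m _) ⟩
  sumTo n (λ a → + sumℕ m (λ b → f a b * g (n ∸ a) (m ∸ b)))
    ≡⟨ sumTo-pos n _ ⟩
  toPS (f ⊛ℕ g) n m ∎

monomial : ℤ → ℕ → ℕ → PS
monomial c i j n m = if does (n ≟ i) ∧ does (m ≟ j) then c else + 0

monomial-⊛ : ∀ c i j g n m → (monomial c i j ⊛ g) n m ≡
  sumTo n (λ a → if does (a ≟ i)
                 then sumTo m (λ b → if does (b ≟ j) then c ℤ.* g (n ∸ a) (m ∸ b) else + 0)
                 else + 0)
monomial-⊛ c i j g n m = sumTo-cong n λ a →
  trans (sumTo-cong m (λ b → if-∧-* (does (a ≟ i)) (does (b ≟ j)) (g (n ∸ a) (m ∸ b))))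
        (sumTo-if m (does (a ≟ i)) _)
  where
  if-∧-* : ∀ u v z → (if u ∧ v then c else + 0) ℤ.* z ≡ (if u then (if v then c ℤ.* z else + 0) else + 0)
  if-∧-* true  true  z = refl
  if-∧-* true  false z = refl
  if-∧-* false v     z = refl

monomial-⊛-≤ : ∀ c {i j} n m g → i ≤ n → j ≤ m → (monomial c i j ⊛ g) n m ≡ c ℤ.* g (n ∸ i) (m ∸ j)
monomial-⊛-≤ c {i} {j} n m g i≤n j≤m =
  trans (monomial-⊛ c i j g n m) (trans (sumTo-δ _ i≤n) (sumTo-δ _ j≤m))

monomial-⊛-<ˡ : ∀ c {i} j {n} m g → n < i → (monomial c i j ⊛ g) n m ≡ + 0
monomial-⊛-<ˡ c {i} j {n} m g n<i = trans (monomial-⊛ c i j g n m) (sumTo-δ-< _ n<i)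

monomial-⊛-<ʳ : ∀ c {i j} n m g → i ≤ n → m < j → (monomial c i j ⊛ g) n m ≡ + 0
monomial-⊛-<ʳ c {i} {j} n m g i≤n m<j =
  trans (monomial-⊛ c i j g n m) (trans (sumTo-δ _ i≤n) (sumTo-δ-< _ m<j))

numFactor-⊛ : ∀ i g x y {u v w} →
  (monomial (+ 1) 0 0 ⊛ g) x y ≡ u → (monomial (+ 1) i 0 ⊛ g) x y ≡ v → (monomial (- + 1) i 1 ⊛ g) x y ≡ w →
  (numFactor i ⊛ g) x y ≡ (u ℤ.+ v) ℤ.+ w
numFactor-⊛ i g x y refl refl refl = begin
  (((monomial (+ 1) 0 0 ⊕ monomial (+ 1) i 0) ⊕ monomial (- + 1) i 1) ⊛ g) x y
    ≡⟨ ⊛-distribʳ-⊕ (monomial (+ 1) 0 0 ⊕ monomial (+ 1) i 0) (monomial (- + 1) i 1) g x y ⟩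
  ((monomial (+ 1) 0 0 ⊕ monomial (+ 1) i 0) ⊛ g) x y ℤ.+ (monomial (- + 1) i 1 ⊛ g) x y
    ≡⟨ cong (ℤ._+ (monomial (- + 1) i 1 ⊛ g) x y)
            (⊛-distribʳ-⊕ (monomial (+ 1) 0 0) (monomial (+ 1) i 0) g x y) ⟩
  ((monomial (+ 1) 0 0 ⊛ g) x y ℤ.+ (monomial (+ 1) i 0 ⊛ g) x y) ℤ.+ (monomial (- + 1) i 1 ⊛ g) x y ∎

numFactor-⊛-< : ∀ {i x} g y → x < i → (numFactor i ⊛ g) x y ≡ g x y
numFactor-⊛-< {i} {x} g y x<i = begin
  (numFactor i ⊛ g) x y
    ≡⟨ numFactor-⊛ i g x y (monomial-⊛-≤ (+ 1) x y g z≤n z≤n)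
                           (monomial-⊛-<ˡ (+ 1) 0 y g x<i)
                           (monomial-⊛-<ˡ (- + 1) 1 y g x<i) ⟩
  (+ 1 ℤ.* g x y ℤ.+ + 0) ℤ.+ + 0
    ≡⟨ trans (ℤ.+-identityʳ _) (trans (ℤ.+-identityʳ _) (ℤ.*-identityˡ (g x y))) ⟩
  g x y ∎

numFactor-⊛-≤-zero : ∀ {i x} g → i ≤ x → (numFactor i ⊛ g) x 0 ≡ g x 0 ℤ.+ g (x ∸ i) 0
numFactor-⊛-≤-zero {i} {x} g i≤x = begin
  (numFactor i ⊛ g) x 0
    ≡⟨ numFactor-⊛ i g x 0 (monomial-⊛-≤ (+ 1) x 0 g z≤n z≤n)
                           (monomial-⊛-≤ (+ 1) x 0 g i≤x z≤n)
                           (monomial-⊛-<ʳ (- + 1) x 0 g i≤x (ℕ.n<1+n 0)) ⟩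
  (+ 1 ℤ.* g x 0 ℤ.+ + 1 ℤ.* g (x ∸ i) 0) ℤ.+ + 0
    ≡⟨ trans (ℤ.+-identityʳ _) (cong₂ ℤ._+_ (ℤ.*-identityˡ (g x 0)) (ℤ.*-identityˡ (g (x ∸ i) 0))) ⟩
  g x 0 ℤ.+ g (x ∸ i) 0 ∎

numFactor-⊛-≤-suc : ∀ {i x} g y → i ≤ x →
  (numFactor i ⊛ g) x (suc y) ≡ (g x (suc y) ℤ.+ g (x ∸ i) (suc y)) ℤ.- g (x ∸ i) y
numFactor-⊛-≤-suc {i} {x} g y i≤x = begin
  (numFactor i ⊛ g) x (suc y)
    ≡⟨ numFactor-⊛ i g x (suc y) (monomial-⊛-≤ (+ 1) x (suc y) g z≤n z≤n)
                                 (monomial-⊛-≤ (+ 1) x (suc y) g i≤x z≤n)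
                                 (monomial-⊛-≤ (- + 1) x (suc y) g i≤x (s≤s (z≤n {y}))) ⟩
  (+ 1 ℤ.* g x (suc y) ℤ.+ + 1 ℤ.* g (x ∸ i) (suc y)) ℤ.+ - + 1 ℤ.* g (x ∸ i) y
    ≡⟨ cong₂ ℤ._+_ (cong₂ ℤ._+_ (ℤ.*-identityˡ (g x (suc y))) (ℤ.*-identityˡ (g (x ∸ i) (suc y))))
                   (ℤ.-1*i≡-i (g (x ∸ i) y)) ⟩
  (g x (suc y) ℤ.+ g (x ∸ i) (suc y)) ℤ.- g (x ∸ i) y ∎

geomCoeff : ℕ → ℕ → ℕ → ℕ
geomCoeff i x d = if does (x ≟ i * d) then 1 else 0

denFactor≡geomCoeff : ∀ i x d → denFactor i x d ≡ + geomCoeff i x d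
denFactor≡geomCoeff i x d with does (x ≟ i * d)
... | true  = refl
... | false = refl

geomCoeff-shift : ∀ {i x} d → i ≤ x → geomCoeff i (x ∸ i) d ≡ geomCoeff i x (suc d)
geomCoeff-shift {i} {x} d i≤x =
  cong (λ b → if b then 1 else 0) (does-⇔ (mk⇔ to from) (x ∸ i ≟ i * d) (x ≟ i * suc d))
  where
  to : x ∸ i ≡ i * d → x ≡ i * suc d
  to e = trans (sym (ℕ.m+[n∸m]≡n i≤x)) (trans (cong (_+_ i) e) (sym (ℕ.*-suc i d)))
  from : x ≡ i * suc d → x ∸ i ≡ i * d
  from e = trans (cong (_∸ i) (trans e (ℕ.*-suc i d))) (ℕ.m+n∸m≡n i (i * d))

geomCoeff-< : ∀ {i x} d → x < i → geomCoeff i x (suc d) ≡ 0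
geomCoeff-< {i} {x} d x<i = if-≟-≢ x (i * suc d) 1 0 λ e →
  ℕ.<⇒≱ x<i (ℕ.≤-trans (ℕ.m≤m+n i (i * d)) (ℕ.≤-reflexive (sym (trans e (ℕ.*-suc i d)))))

-- The coefficient of qˣ wʸ in (1 - (w-1) qⁱ) / (1 - w qⁱ) = 1 + Σ_{d≥1} w^{d-1} q^{i d}.
factorCoeff : ℕ → ℕ → ℕ → ℕ
factorCoeff i x zero    = geomCoeff i x 0 + geomCoeff i x 1
factorCoeff i x (suc y) = geomCoeff i x (suc (suc y))

numFactor⊛denFactor : ∀ i x y → (numFactor i ⊛ denFactor i) x y ≡ + factorCoeff i x y
numFactor⊛denFactor i x = coefficient (i ≤? x)
  where
  D : ℕ → ℕ → ℤ
  D = denFactor i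
  coefficient : Dec (i ≤ x) → ∀ y → (numFactor i ⊛ D) x y ≡ + factorCoeff i x y
  coefficient (yes i≤x) zero = begin
    (numFactor i ⊛ D) x 0
      ≡⟨ numFactor-⊛-≤-zero D i≤x ⟩
    D x 0 ℤ.+ D (x ∸ i) 0
      ≡⟨ cong₂ ℤ._+_ (denFactor≡geomCoeff i x 0) (denFactor≡geomCoeff i (x ∸ i) 0) ⟩
    + geomCoeff i x 0 ℤ.+ + geomCoeff i (x ∸ i) 0
      ≡⟨ cong (λ k → + geomCoeff i x 0 ℤ.+ + k) (geomCoeff-shift 0 i≤x) ⟩
    + geomCoeff i x 0 ℤ.+ + geomCoeff i x 1
      ≡⟨ ℤ.pos-+ (geomCoeff i x 0) (geomCoeff i x 1) ⟨
    + factorCoeff i x 0 ∎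
  coefficient (yes i≤x) (suc y) = begin
    (numFactor i ⊛ D) x (suc y)
      ≡⟨ numFactor-⊛-≤-suc D y i≤x ⟩
    (D x (suc y) ℤ.+ D (x ∸ i) (suc y)) ℤ.- D (x ∸ i) y
      ≡⟨ cong₂ (λ u v → (D x (suc y) ℤ.+ u) ℤ.- v) (shift (suc y)) (shift y) ⟩
    (D x (suc y) ℤ.+ D x (suc (suc y))) ℤ.- D x (suc y)
      ≡⟨ xyx⁻¹≈y ℤ.+-0-abelianGroup (D x (suc y)) (D x (suc (suc y))) ⟩
    D x (suc (suc y))
      ≡⟨ denFactor≡geomCoeff i x (suc (suc y)) ⟩
    + factorCoeff i x (suc y) ∎
    where
    shift : ∀ d → D (x ∸ i) d ≡ D x (suc d)
    shift d = trans (denFactor≡geomCoeff i (x ∸ i) d)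
                    (trans (cong +_ (geomCoeff-shift d i≤x)) (sym (denFactor≡geomCoeff i x (suc d))))
  coefficient (no i≰x) zero = begin
    (numFactor i ⊛ D) x 0     ≡⟨ numFactor-⊛-< D 0 (ℕ.≰⇒> i≰x) ⟩
    D x 0                     ≡⟨ denFactor≡geomCoeff i x 0 ⟩
    + geomCoeff i x 0         ≡⟨ cong +_ (ℕ.+-identityʳ _) ⟨
    + (geomCoeff i x 0 + 0)   ≡⟨ cong (λ k → + (geomCoeff i x 0 + k)) (geomCoeff-< 0 (ℕ.≰⇒> i≰x)) ⟨
    + factorCoeff i x 0       ∎
  coefficient (no i≰x) (suc y) = begin
    (numFactor i ⊛ D) x (suc y) ≡⟨ numFactor-⊛-< D (suc y) (ℕ.≰⇒> i≰x) ⟩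
    D x (suc y)                 ≡⟨ denFactor≡geomCoeff i x (suc y) ⟩
    + geomCoeff i x (suc y)     ≡⟨ cong +_ (geomCoeff-< y (ℕ.≰⇒> i≰x)) ⟩
    + 0                         ≡⟨ cong +_ (geomCoeff-< (suc y) (ℕ.≰⇒> i≰x)) ⟨
    + factorCoeff i x (suc y)   ∎

partialProductℕ : ℕ → ℕ → ℕ → ℕ
partialProductℕ zero    zero    zero = 1
partialProductℕ zero    _       _    = 0
partialProductℕ (suc N) n       m    = (partialProductℕ N ⊛ℕ factorCoeff (suc N)) n m

partialProduct≡partialProductℕ : ∀ N n m → partialProduct N n m ≡ + partialProductℕ N n m
partialProduct≡partialProductℕ zero    zero    zero    = refl
partialProduct≡partialProductℕ zero    zero    (suc m) = refl
partialProduct≡partialProductℕ zero    (suc n) m       = refl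
partialProduct≡partialProductℕ (suc N) n       m       =
  trans (⊛-cong (partialProduct≡partialProductℕ N) (numFactor⊛denFactor (suc N)) n m)
        (⊛-toPS (partialProductℕ N) (factorCoeff (suc N)) n m)

-- Thanks to truncated subtraction, repeated entries and leading zeros contribute no gaps.
gaps : ℕ → List ℕ → ℕ
gaps b []       = 0
gaps b (x ∷ xs) = (x ∸ b ∸ 1) + gaps x xs

SortedTuple : ℕ → Set
SortedTuple N = Σ (List ℕ) λ v → length v ≡ N × Linked _≤_ v

SortedTuple-irrelevant : ∀ {N v} → Irrelevant (length v ≡ N × Linked _≤_ v)
SortedTuple-irrelevant = ×-irrelevant ℕ.≡-irrelevant (Linked.irrelevant ℕ.≤-irrelevant)

TupleFiber : ℕ → ℕ → ℕ → Set
TupleFiber N = Fiber {SortedTuple N} (sum ∘ proj₁) (gaps 0 ∘ proj₁)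

FactorTerm : ℕ → ℕ → ℕ → Set
FactorTerm i = Fiber {ℕ} (i *_) (_∸ 1)

FactorTerm-zero↔ : ∀ {i x} → FactorTerm i x 0 ↔ (i * 0 ≡ x ⊎ i * 1 ≡ x)
FactorTerm-zero↔ {i} {x} = mk↔ₛ′ to from (λ { (inj₁ _) → refl ; (inj₂ _) → refl }) from-to
  where
  to : FactorTerm i x 0 → i * 0 ≡ x ⊎ i * 1 ≡ x
  to (0 , e , _) = inj₁ e
  to (1 , e , _) = inj₂ e
  from : i * 0 ≡ x ⊎ i * 1 ≡ x → FactorTerm i x 0
  from (inj₁ e) = 0 , e , refl
  from (inj₂ e) = 1 , e , refl
  from-to : ∀ t → from (to t) ≡ t
  from-to (0 , _ , refl) = refl
  from-to (1 , _ , refl) = refl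

FactorTerm-suc↔ : ∀ {i x y} → FactorTerm i x (suc y) ↔ (i * suc (suc y) ≡ x)
FactorTerm-suc↔ {i} {x} = mk↔ₛ′ to (λ e → _ , e , refl) (λ _ → refl) from-to
  where
  to : ∀ {y} → FactorTerm i x (suc y) → i * suc (suc y) ≡ x
  to (suc (suc _) , e , refl) = e
  from-to : ∀ {y} (t : FactorTerm i x (suc y)) → (_ , to t , refl) ≡ t
  from-to (suc (suc _) , _ , refl) = refl

card-FactorTerm : ∀ i x y → HasCard (FactorTerm i x y) (factorCoeff i x y)
card-FactorTerm i x zero    = ↔-trans (FactorTerm-zero↔ {i}) (card-⊎ (card-≡ (i * 0) x) (card-≡ (i * 1) x))
card-FactorTerm i x (suc y) = ↔-trans (FactorTerm-suc↔ {i}) (card-≡ (i * suc (suc y)) x)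

raise lower : ℕ → List ℕ → List ℕ
raise d = map (λ x → d + x)
lower d = map (_∸ d)

≤-head-All : ∀ {d v} → Linked _≤_ (d ∷ v) → All (d ≤_) v
≤-head-All sorted with Linked⇒AllPairs ℕ.≤-trans sorted
... | d≤v ∷ _ = d≤v

sum-raise : ∀ d u → sum (raise d u) ≡ length u * d + sum u
sum-raise d []      = refl
sum-raise d (x ∷ u) = trans (cong (_+_ (d + x)) (sum-raise d u)) (ℕ+.interchange d x (length u * d) (sum u))

gaps-raise : ∀ d b u → gaps (d + b) (raise d u) ≡ gaps b u
gaps-raise d b []      = refl
gaps-raise d b (x ∷ u) = cong₂ _+_ (cong (_∸ 1) (ℕ.[m+n]∸[m+o]≡n∸o d x b)) (gaps-raise d x u)

prepend : ∀ {N} → SortedTuple N × ℕ → SortedTuple (suc N)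
prepend ((u , len , sorted) , d) =
  d ∷ raise d u ,
  cong suc (trans (List.length-map _ u) len) ,
  d≤head u ∷′ map⁺ (Linked.map (ℕ.+-monoʳ-≤ d) sorted)
  where
  d≤head : ∀ u → Connected _≤_ (just d) (head (raise d u))
  d≤head []      = just-nothing
  d≤head (x ∷ _) = just (ℕ.m≤m+n d x)

peel : ∀ {N} → SortedTuple (suc N) → SortedTuple N × ℕ
peel (d ∷ v , len , sorted) =
  (lower d v , trans (List.length-map _ v) (ℕ.suc-injective len) ,
   map⁺ (Linked.map (ℕ.∸-monoˡ-≤ d) (Linked.tail sorted))) ,
  d

prepend↔ : ∀ {N} → (SortedTuple N × ℕ) ↔ SortedTuple (suc N)
prepend↔ = mk↔ₛ′ prepend peel prepend-peel peel-prepend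
  where
  prepend-peel : ∀ {N} (v : SortedTuple (suc N)) → prepend (peel v) ≡ v
  prepend-peel (d ∷ v , _ , sorted) = Σ-≡-irrelevant SortedTuple-irrelevant (cong (d ∷_) (begin
    raise d (lower d v)        ≡⟨ List.map-∘ v ⟨
    map (λ x → d + (x ∸ d)) v ≡⟨ List.map-id-local (All.map ℕ.m+[n∸m]≡n (≤-head-All sorted)) ⟩
    v                          ∎))
  peel-prepend : ∀ {N} (p : SortedTuple N × ℕ) → peel (prepend p) ≡ p
  peel-prepend ((u , _) , d) = cong (_, d) (Σ-≡-irrelevant SortedTuple-irrelevant (begin
    lower d (raise d u)      ≡⟨ List.map-∘ u ⟨
    map (λ x → d + x ∸ d) u ≡⟨ List.map-cong (ℕ.m+n∸m≡n d) u ⟩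
    map (λ x → x) u         ≡⟨ List.map-id u ⟩
    u                        ∎))

sum-prepend : ∀ {N} (p : SortedTuple N × ℕ) →
              sum (proj₁ (prepend p)) ≡ sum (proj₁ (proj₁ p)) + suc N * proj₂ p
sum-prepend ((u , refl , _) , d) = begin
  d + sum (raise d u)         ≡⟨ cong (_+_ d) (sum-raise d u) ⟩
  d + (length u * d + sum u)  ≡⟨ ℕ.+-assoc d (length u * d) (sum u) ⟨
  suc (length u) * d + sum u  ≡⟨ ℕ.+-comm (suc (length u) * d) (sum u) ⟩
  sum u + suc (length u) * d  ∎

gaps-prepend : ∀ {N} (p : SortedTuple N × ℕ) →
               gaps 0 (proj₁ (prepend p)) ≡ gaps 0 (proj₁ (proj₁ p)) + (proj₂ p ∸ 1)
gaps-prepend ((u , _) , d) = begin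
  (d ∸ 1) + gaps d (raise d u)        ≡⟨ cong (λ b → (d ∸ 1) + gaps b (raise d u)) (ℕ.+-identityʳ d) ⟨
  (d ∸ 1) + gaps (d + 0) (raise d u)  ≡⟨ cong (_+_ (d ∸ 1)) (gaps-raise d 0 u) ⟩
  (d ∸ 1) + gaps 0 u                  ≡⟨ ℕ.+-comm (d ∸ 1) (gaps 0 u) ⟩
  gaps 0 u + (d ∸ 1)                  ∎

TupleFiber-suc↔ : ∀ {N n m} → TupleFiber (suc N) n m ↔ Convolution (TupleFiber N) (FactorTerm (suc N)) n m
TupleFiber-suc↔ = ↔-trans (↔-sym (Fiber-↔ prepend↔ sum-prepend gaps-prepend)) Fiber-×↔Convolution

card-TupleFiber : ∀ N n m → HasCard (TupleFiber N n m) (partialProductℕ N n m)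
card-TupleFiber zero    zero    zero    =
  card-singleton (([] , refl , []) , refl , refl) λ { (([] , refl , []) , refl , refl) → refl }
card-TupleFiber zero    zero    (suc m) = card-empty λ { (([] , refl , []) , _ , ()) }
card-TupleFiber zero    (suc n) m       = card-empty λ { (([] , refl , []) , () , _) }
card-TupleFiber (suc N) n       m       =
  ↔-trans TupleFiber-suc↔ (card-Convolution (card-TupleFiber N) (card-FactorTerm (suc N)) n m)

PartList : (ℕ → ℕ → Set) → Set
PartList R = Σ (List ℕ) λ ρ → All (0 <_) ρ × Linked R ρ

PartList-irrelevant : ∀ {R : ℕ → ℕ → Set} → (∀ {a b} → Irrelevant (R a b)) →
                      ∀ {ρ} → Irrelevant (All (0 <_) ρ × Linked R ρ)
PartList-irrelevant irr = ×-irrelevant (All.irrelevant ℕ.<-irrelevant) (Linked.irrelevant irr)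

Partition AscPartition : Set
Partition    = PartList _≥_
AscPartition = PartList _≤_

AscFiber : ℕ → ℕ → Set
AscFiber = Fiber {AscPartition} (sum ∘ proj₁) (gaps 0 ∘ proj₁)

dropZeros : List ℕ → List ℕ
dropZeros (zero ∷ v) = dropZeros v
dropZeros v          = v

leadingZeros : List ℕ → ℕ
leadingZeros (zero ∷ v) = suc (leadingZeros v)
leadingZeros v          = 0

zeros++dropZeros : ∀ v → replicate (leadingZeros v) 0 ++ dropZeros v ≡ v
zeros++dropZeros []          = refl
zeros++dropZeros (zero ∷ v)  = cong (0 ∷_) (zeros++dropZeros v)
zeros++dropZeros (suc x ∷ v) = refl

dropZeros-zeros++ : ∀ k {ρ} → All (0 <_) ρ → dropZeros (replicate k 0 ++ ρ) ≡ ρ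
dropZeros-zeros++ zero    {[]}        _   = refl
dropZeros-zeros++ zero    {suc _ ∷ _} _   = refl
dropZeros-zeros++ zero    {zero ∷ _} (() ∷ _)
dropZeros-zeros++ (suc k) pos             = dropZeros-zeros++ k pos

length-zeros++ : ∀ k ρ → length (replicate k 0 ++ ρ) ≡ k + length ρ
length-zeros++ zero    ρ = refl
length-zeros++ (suc k) ρ = cong suc (length-zeros++ k ρ)

sum-zeros++ : ∀ k ρ → sum (replicate k 0 ++ ρ) ≡ sum ρ
sum-zeros++ zero    ρ = refl
sum-zeros++ (suc k) ρ = sum-zeros++ k ρ

gaps-zeros++ : ∀ k ρ → gaps 0 (replicate k 0 ++ ρ) ≡ gaps 0 ρ
gaps-zeros++ zero    ρ = refl
gaps-zeros++ (suc k) ρ = gaps-zeros++ k ρ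

Linked-zeros++ : ∀ k {ρ} → Linked _≤_ ρ → Linked _≤_ (replicate k 0 ++ ρ)
Linked-zeros++ zero    sorted = sorted
Linked-zeros++ (suc k) sorted = 0≤head (replicate k 0 ++ _) ∷′ Linked-zeros++ k sorted
  where
  0≤head : ∀ v → Connected _≤_ (just 0) (head v)
  0≤head []      = just-nothing
  0≤head (_ ∷ _) = just z≤n

sum-dropZeros : ∀ v → sum (dropZeros v) ≡ sum v
sum-dropZeros []          = refl
sum-dropZeros (zero ∷ v)  = sum-dropZeros v
sum-dropZeros (suc x ∷ v) = refl

gaps-dropZeros : ∀ v → gaps 0 (dropZeros v) ≡ gaps 0 v
gaps-dropZeros []          = refl
gaps-dropZeros (zero ∷ v)  = gaps-dropZeros v
gaps-dropZeros (suc x ∷ v) = refl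

length-dropZeros : ∀ v → leadingZeros v + length (dropZeros v) ≡ length v
length-dropZeros []          = refl
length-dropZeros (zero ∷ v)  = cong suc (length-dropZeros v)
length-dropZeros (suc x ∷ v) = refl

dropZeros-sorted : ∀ {v} → Linked _≤_ v → Linked _≤_ (dropZeros v)
dropZeros-sorted {[]}        sorted = sorted
dropZeros-sorted {zero ∷ v}  sorted = dropZeros-sorted (Linked.tail sorted)
dropZeros-sorted {suc x ∷ v} sorted = sorted

dropZeros-positive : ∀ {v} → Linked _≤_ v → All (0 <_) (dropZeros v)
dropZeros-positive {[]}        sorted = []
dropZeros-positive {zero ∷ v}  sorted = dropZeros-positive (Linked.tail sorted)
dropZeros-positive {suc x ∷ v} sorted = s≤s z≤n ∷ All.map (ℕ.≤-trans (s≤s z≤n)) (≤-head-All sorted)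

length≤sum : ∀ {ρ} → All (0 <_) ρ → length ρ ≤ sum ρ
length≤sum []        = z≤n
length≤sum (p ∷ pos) = ℕ.+-mono-≤ p (length≤sum pos)

AscFiber↔TupleFiber : ∀ {N n m} → n ≤ N → AscFiber n m ↔ TupleFiber N n m
AscFiber↔TupleFiber {N} {n} {m} n≤N = mk↔ₛ′ pad strip pad-strip strip-pad
  where
  pad : AscFiber n m → TupleFiber N n m
  pad ((ρ , pos , sorted) , s , g) =
    (replicate (N ∸ length ρ) 0 ++ ρ ,
     trans (length-zeros++ (N ∸ length ρ) ρ) (ℕ.m∸n+n≡m length≤N) ,
     Linked-zeros++ (N ∸ length ρ) sorted) ,
    trans (sum-zeros++ (N ∸ length ρ) ρ) s ,
    trans (gaps-zeros++ (N ∸ length ρ) ρ) g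
    where
    length≤N : length ρ ≤ N
    length≤N = ℕ.≤-trans (length≤sum pos) (ℕ.≤-trans (ℕ.≤-reflexive s) n≤N)
  strip : TupleFiber N n m → AscFiber n m
  strip ((v , _ , sorted) , s , g) =
    (dropZeros v , dropZeros-positive sorted , dropZeros-sorted sorted) ,
    trans (sum-dropZeros v) s ,
    trans (gaps-dropZeros v) g
  pad-strip : ∀ t → pad (strip t) ≡ t
  pad-strip ((v , len , _) , _) = Fiber-≡ SortedTuple-irrelevant (begin
    replicate (N ∸ length (dropZeros v)) 0 ++ dropZeros v ≡⟨ cong (λ k → replicate k 0 ++ dropZeros v) padding ⟩
    replicate (leadingZeros v) 0 ++ dropZeros v           ≡⟨ zeros++dropZeros v ⟩
    v                                                     ∎)
    where
    padding : N ∸ length (dropZeros v) ≡ leadingZeros v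
    padding = begin
      N ∸ length (dropZeros v)
        ≡⟨ cong (_∸ length (dropZeros v)) (trans (length-dropZeros v) len) ⟨
      leadingZeros v + length (dropZeros v) ∸ length (dropZeros v)
        ≡⟨ ℕ.m+n∸n≡m (leadingZeros v) (length (dropZeros v)) ⟩
      leadingZeros v ∎
  strip-pad : ∀ a → strip (pad a) ≡ a
  strip-pad ((ρ , pos , _) , _) =
    Fiber-≡ (PartList-irrelevant ℕ.≤-irrelevant) (dropZeros-zeros++ (N ∸ length ρ) pos)

Linked-reverseAcc : {A : Set} {R : A → A → Set} {x : A} {xs acc : List A} →
  Linked (flip R) (x ∷ xs) → Linked R (x ∷ acc) → Linked R (reverseAcc acc (x ∷ xs))
Linked-reverseAcc [-]      sorted = sorted
Linked-reverseAcc (r ∷ rs) sorted = Linked-reverseAcc rs (r ∷ sorted)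

Linked-reverse : {A : Set} {R : A → A → Set} {xs : List A} → Linked (flip R) xs → Linked R (reverse xs)
Linked-reverse {xs = []}    []     = []
Linked-reverse {xs = _ ∷ _} sorted = Linked-reverseAcc sorted [-]

reverse↔ : Partition ↔ AscPartition
reverse↔ = mk↔ₛ′ reverse-parts reverse-parts (involutive ℕ.≤-irrelevant) (involutive ℕ.≤-irrelevant)
  where
  reverse-parts : {R : ℕ → ℕ → Set} → PartList (flip R) → PartList R
  reverse-parts (ρ , pos , linked) = reverse ρ , All-resp-↭ (↭-sym (↭-reverse ρ)) pos , Linked-reverse linked
  involutive : ∀ {R : ℕ → ℕ → Set} → (∀ {a b} → Irrelevant (R a b)) →
               ∀ p → reverse-parts {R} (reverse-parts p) ≡ p
  involutive irr (ρ , _) = Σ-≡-irrelevant (PartList-irrelevant irr) (List.reverse-involutive ρ)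

sum-reverse : ∀ (p : Partition) → sum (reverse (proj₁ p)) ≡ sum (proj₁ p)
sum-reverse (π , _) = sum-↭ (↭-reverse π)

missingUpTo : List ℕ → ℕ → ℕ
missingUpTo π L = length (filter (_∉? π) (map suc (upTo L)))

missingUpTo-suc : ∀ π L →
  missingUpTo π (suc L) ≡ missingUpTo π L + length (filter (_∉? π) [ suc L ])
missingUpTo-suc π L = begin
  length (filter P? (map suc (upTo (suc L))))
    ≡⟨ cong (length ∘ filter P? ∘ map suc) (List.upTo-∷ʳ L) ⟨
  length (filter P? (map suc (upTo L ++ [ L ])))
    ≡⟨ cong (length ∘ filter P?) (List.map-++ suc (upTo L) [ L ]) ⟩
  length (filter P? (map suc (upTo L) ++ [ suc L ]))
    ≡⟨ cong length (List.filter-++ P? (map suc (upTo L)) [ suc L ]) ⟩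
  length (filter P? (map suc (upTo L)) ++ filter P? [ suc L ])
    ≡⟨ List.length-++ (filter P? (map suc (upTo L))) ⟩
  missingUpTo π L + length (filter P? [ suc L ]) ∎
  where
  P? = _∉? π

missingUpTo-∈ : ∀ {π L} → suc L ∈ π → missingUpTo π (suc L) ≡ missingUpTo π L
missingUpTo-∈ {π} {L} ∈π = begin
  missingUpTo π (suc L)                          ≡⟨ missingUpTo-suc π L ⟩
  missingUpTo π L + length (filter (_∉? π) [ suc L ])
    ≡⟨ cong (λ xs → missingUpTo π L + length xs) (List.filter-reject (_∉? π) (λ ∉π → ∉π ∈π)) ⟩
  missingUpTo π L + 0                            ≡⟨ ℕ.+-identityʳ _ ⟩
  missingUpTo π L                                ∎

missingUpTo-∉ : ∀ {π L} → suc L ∉ π → missingUpTo π (suc L) ≡ suc (missingUpTo π L)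
missingUpTo-∉ {π} {L} ∉π = begin
  missingUpTo π (suc L)                          ≡⟨ missingUpTo-suc π L ⟩
  missingUpTo π L + length (filter (_∉? π) [ suc L ])
    ≡⟨ cong (λ xs → missingUpTo π L + length xs) (List.filter-accept (_∉? π) ∉π) ⟩
  missingUpTo π L + 1                            ≡⟨ ℕ.+-comm _ 1 ⟩
  suc (missingUpTo π L)                          ∎

missingUpTo-∷ : ∀ {x π} L → L < x → missingUpTo (x ∷ π) L ≡ missingUpTo π L
missingUpTo-∷         zero    _   = refl
missingUpTo-∷ {x} {π} (suc L) L<x with suc L ∈? π | missingUpTo-∷ {x} {π} L (ℕ.<-trans (ℕ.n<1+n L) L<x)
... | yes ∈π | ih = trans (missingUpTo-∈ (there ∈π)) (trans ih (sym (missingUpTo-∈ ∈π)))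
... | no ∉π  | ih = trans (missingUpTo-∉ ∉x∷π) (trans (cong suc ih) (sym (missingUpTo-∉ ∉π)))
  where
  ∉x∷π : suc L ∉ x ∷ π
  ∉x∷π (here refl) = ℕ.<-irrefl refl L<x
  ∉x∷π (there ∈π)  = ∉π ∈π

missingUpTo-+ : ∀ {π y} → All (_≤ y) π → ∀ j → missingUpTo π (y + j) ≡ missingUpTo π y + j
missingUpTo-+ {π} {y} ≤y zero    = trans (cong (missingUpTo π) (ℕ.+-identityʳ y)) (sym (ℕ.+-identityʳ _))
missingUpTo-+ {π} {y} ≤y (suc j) = begin
  missingUpTo π (y + suc j)     ≡⟨ cong (missingUpTo π) (ℕ.+-suc y j) ⟩
  missingUpTo π (suc (y + j))   ≡⟨ missingUpTo-∉ (λ ∈π → ℕ.<⇒≱ (s≤s (ℕ.m≤m+n y j)) (All.lookup ≤y ∈π)) ⟩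
  suc (missingUpTo π (y + j))   ≡⟨ cong suc (missingUpTo-+ ≤y j) ⟩
  suc (missingUpTo π y + j)     ≡⟨ ℕ.+-suc _ j ⟨
  missingUpTo π y + suc j       ∎

missingUpTo-past-max : ∀ {π y} → All (_≤ suc y) π → suc y ∈ π → ∀ d →
                       missingUpTo π (y + d) ≡ missingUpTo π y + (d ∸ 1)
missingUpTo-past-max {π} {y} ≤y ∈π zero    =
  trans (cong (missingUpTo π) (ℕ.+-identityʳ y)) (sym (ℕ.+-identityʳ _))
missingUpTo-past-max {π} {y} ≤y ∈π (suc d) = begin
  missingUpTo π (y + suc d)     ≡⟨ cong (missingUpTo π) (ℕ.+-suc y d) ⟩
  missingUpTo π (suc y + d)     ≡⟨ missingUpTo-+ ≤y d ⟩
  missingUpTo π (suc y) + d     ≡⟨ cong (_+ d) (missingUpTo-∈ ∈π) ⟩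
  missingUpTo π y + d           ∎

descGaps : List ℕ → ℕ
descGaps []      = 0
descGaps (x ∷ π) = descGaps π + (x ∸ largest π ∸ 1)

missing≡descGaps : ∀ {π} → All (0 <_) π → Linked _≥_ π → missing π ≡ descGaps π
missing≡descGaps {[]}                   _                  _                = refl
missing≡descGaps {zero ∷ _}             (() ∷ _)           _
missing≡descGaps {suc x ∷ []}           _                  _                =
  trans (missingUpTo-∷ x ℕ.≤-refl) (missingUpTo-+ {y = 0} [] x)
missing≡descGaps {suc x ∷ zero ∷ _}     (_ ∷ () ∷ _)       _
missing≡descGaps {suc x ∷ suc y ∷ π}    (_ ∷ pos)          (s≤s y≤x ∷ desc) = begin
  missingUpTo (suc x ∷ π′) x         ≡⟨ missingUpTo-∷ x ℕ.≤-refl ⟩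
  missingUpTo π′ x                   ≡⟨ cong (missingUpTo π′) (ℕ.m+[n∸m]≡n y≤x) ⟨
  missingUpTo π′ (y + (x ∸ y))       ≡⟨ missingUpTo-past-max ≤y (here refl) (x ∸ y) ⟩
  missingUpTo π′ y + (x ∸ y ∸ 1)     ≡⟨ cong (_+ (x ∸ y ∸ 1)) (missing≡descGaps pos desc) ⟩
  descGaps π′ + (x ∸ y ∸ 1)          ∎
  where
  π′ = suc y ∷ π
  ≤y : All (_≤ suc y) π′
  ≤y = Linked⇒All (flip ℕ.≤-trans) ℕ.≤-refl desc

gaps-reverseAcc : ∀ acc xs → gaps 0 (reverseAcc acc xs) ≡ descGaps xs + gaps (largest xs) acc
gaps-reverseAcc acc []       = refl
gaps-reverseAcc acc (x ∷ xs) =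
  trans (gaps-reverseAcc (x ∷ acc) xs) (sym (ℕ.+-assoc (descGaps xs) (x ∸ largest xs ∸ 1) (gaps x acc)))

gaps-reverse≡missing : ∀ (p : Partition) → gaps 0 (reverse (proj₁ p)) ≡ missing (proj₁ p)
gaps-reverse≡missing (π , pos , desc) =
  trans (gaps-reverseAcc [] π) (trans (ℕ.+-identityʳ (descGaps π)) (sym (missing≡descGaps pos desc)))

card-PartsWithMissing : ∀ {N n m} → n ≤ N → HasCard (PartsWithMissing n m) (partialProductℕ N n m)
card-PartsWithMissing {N} {n} {m} n≤N =
  ↔-trans reassociate
    (↔-trans (Fiber-↔ reverse↔ sum-reverse gaps-reverse≡missing)
      (↔-trans (AscFiber↔TupleFiber n≤N) (card-TupleFiber N n m)))
  where
  reassociate : PartsWithMissing n m ↔ Fiber {Partition} (sum ∘ proj₁) (missing ∘ proj₁) n m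
  reassociate = mk↔ₛ′ (λ (π , (pos , desc , s) , g) → (π , pos , desc) , s , g)
                      (λ ((π , pos , desc) , s , g) → π , (pos , desc , s) , g)
                      (λ _ → refl) (λ _ → refl)

corollary2p2 : (n m : ℕ) → Σ ℕ (λ k → HasCard (PartsWithMissing n m) k × ((N : ℕ) → n ≤ N → partialProduct N n m ≡ + k))
corollary2p2 n m = partialProductℕ n n m , card-PartsWithMissing ℕ.≤-refl , λ N n≤N →
  trans (partialProduct≡partialProductℕ N n m)
        (cong +_ (card-unique (card-PartsWithMissing n≤N) (card-PartsWithMissing ℕ.≤-refl)))
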